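{- Let $T$ be a finite tree with a rooted planar embedding whose root is a leaf, and let $E$ be the set of edges from each vertex to its first child (in the planar order used by depth-first search). Then the tree with capacities associated to $(T,E)$ has distributable capacity. Moreover, if $E'\subseteq E(T)$ with $E'\cap E=\emptyset$ and $U$ is a connected component of $T\setminus E'$, then the tree with capacities associated to $(U,E\cap E(U))$ also has distributable capacity.
   Context: Given a tree $U$ with all vertex capacities $1$ and an edge set $E''\subseteq E(U)$, the associated tree with capacities has as vertices the connected components of $U\setminus E''$, as edges the edges in $E''$, and each component has capacity equal to its number of vertices. A tree with capacities has distributable capacity if every vertex $v$ satisfies $\mathrm{cap}(v)\ge\deg(v)-1$. -}

module Defs where

open import Data.Nat using (ℕ; zero; suc; _+_; _∸_; _≤_; _<?_)
open import Data.Bool using (Bool; true; false; _∧_; _∨_; not)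
open import Data.List using (List; []; _∷_; _++_; length; lookup)
open import Data.Fin using (Fin; toℕ; fromℕ<)
open import Data.Fin.Subset using (Subset; _∈_; _∉_; _⊆_; ∣_∣; ∁; _∩_; ⊤)
open import Data.Vec using (tabulate)
import Data.Vec as Vec
open import Data.Product using (Σ; ∃; ∃-syntax; _×_; _,_; proj₁; proj₂)
open import Data.Sum using (_⊎_)
open import Relation.Binary.PropositionalEquality using (_≡_)
open import Relation.Nullary using (yes; no)
open import Function.Bundles using (_⇔_)

-- Finite rooted planar (= ordered) trees: the children of a vertex are
-- given as a list, in their planar (left-to-right) order.

data PTree : Set where
  node : List PTree → PTree

mutual
  size : PTree → ℕ
  size (node ts) = suc (sizes ts)

  sizes : List PTree → ℕ
  sizes []       = 0
  sizes (t ∷ ts) = size t + sizes ts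

record TEdge : Set where
  constructor tedge
  field
    parent : ℕ
    child  : ℕ
    first  : Bool

open TEdge public

-- Vertices are labelled 0 .. size t - 1 in depth-first-search preorder
-- (root = 0).  edgesT o t lists the edges of t, where the root of t has
-- label o.  edgesF p o b ts lists the edges from parent p to the trees
-- ts (whose first root gets label o); b says whether the head of ts is
-- the first child of p.
mutual
  edgesT : ℕ → PTree → List TEdge
  edgesT o (node ts) = edgesF o (suc o) true ts

  edgesF : ℕ → ℕ → Bool → List PTree → List TEdge
  edgesF p o b []       = []
  edgesF p o b (t ∷ ts) =
    tedge p o b ∷ (edgesT o t ++ edgesF p (o + size t) false ts)

edges : PTree → List TEdge
edges t = edgesT 0 t

nE : PTree → ℕ
nE t = length (edges t)

endA : (t : PTree) → Fin (nE t) → ℕ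
endA t e = parent (lookup (edges t) e)

endB : (t : PTree) → Fin (nE t) → ℕ
endB t e = child (lookup (edges t) e)

firstEdges : (t : PTree) → Subset (nE t)
firstEdges t = tabulate (λ e → first (lookup (edges t) e))

memℕ : {n : ℕ} → ℕ → Subset n → Bool
memℕ {n} a C with a <? n
... | yes p = Vec.lookup C (fromℕ< p)
... | no _  = false

Joins : (t : PTree) → Fin (nE t) → Fin (size t) → Fin (size t) → Set
Joins t e u v =
  (endA t e ≡ toℕ u × endB t e ≡ toℕ v) ⊎ (endA t e ≡ toℕ v × endB t e ≡ toℕ u)

data Reach (t : PTree) (K : Subset (nE t)) :
           Fin (size t) → Fin (size t) → Set where
  here : ∀ {u} → Reach t K u u
  step : ∀ {u w v} (e : Fin (nE t)) → e ∈ K → Joins t e u w →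
         Reach t K w v → Reach t K u v

-- C is a connected component of the graph with vertex set V and edge
-- set K (K is assumed to consist of edges with both endpoints in V):
-- C ⊆ V and C is the set of vertices reachable from some c ∈ C.
IsComponent : (t : PTree) → Subset (size t) → Subset (nE t) →
              Subset (size t) → Set
IsComponent t V K C =
  C ⊆ V × ∃[ c ] (c ∈ C × (∀ v → (v ∈ C) ⇔ Reach t K c v))

edgesWithin : (t : PTree) → Subset (nE t) → Subset (size t) → Subset (nE t)
edgesWithin t F U =
  tabulate (λ e → Vec.lookup F e ∧ memℕ (endA t e) U ∧ memℕ (endB t e) U)

degree : (t : PTree) → Subset (nE t) → Subset (size t) → ℕ
degree t E'' C =
  ∣ tabulate (λ e → Vec.lookup E'' e ∧ (memℕ (endA t e) C ∨ memℕ (endB t e) C)) ∣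

-- The tree with capacities associated to (U, E''), where U is the
-- subgraph of t with vertex set V and edge set EV, and E'' ⊆ EV: its
-- vertices are the components C of U ∖ E'' with capacity ∣ C ∣, its edges
-- are the edges of E''.
DistributableCapacity : (t : PTree) → (V : Subset (size t)) →
                        (EV E'' : Subset (nE t)) → Set
DistributableCapacity t V EV E'' =
  ∀ (C : Subset (size t)) → IsComponent t V (EV ∩ ∁ E'') C →
  degree t E'' C ∸ 1 ≤ ∣ C ∣

module Submission where

-- Let E be the first-child edges.  Climbing from a vertex along non-first edges (from a
-- later child to its parent) ends at its "top": a first child or the root.  Top is constant
-- along non-first edges, so every vertex of a component C of a subgraph whose remaining edges
-- avoid E has the same top.  An edge of E incident to C either has its child endpoint in C,
-- and then that child is the common top (at most one such edge), or has its parent endpoint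
-- in C; vertices are numbered in preorder, so the first child of p is p + 1 and these
-- edges are determined by their parents: at most ∣ C ∣ of them.  Hence deg C ≤ ∣ C ∣ + 1.

open import Defs
open import Data.Nat using (ℕ; zero; suc; _+_; _≤_; _<_; _<?_; _≟_; z≤n; s≤s; s≤s⁻¹; z<s)
open import Data.Nat.Properties
open import Data.Bool using (Bool; true; false; T; _∧_; _∨_; if_then_else_)
open import Data.Bool.Properties using (T-≡; T-∧; T-∨)
open import Data.List using (List; []; _∷_; _++_; lookup)
open import Data.List.Relation.Unary.All as All using (All; []; _∷_)
open import Data.List.Relation.Unary.All.Properties using (++⁺)
open import Data.List.Membership.Propositional.Properties using (∈-lookup)
open import Data.Fin using (Fin; toℕ; fromℕ<)
import Data.Fin as Fin
open import Data.Fin.Properties using (toℕ-injective; toℕ-fromℕ<)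
open import Data.Fin.Subset
  using (Subset; outside; inside; _∈_; _∉_; _⊆_; _∪_; _∩_; ∁; ⊤; ⁅_⁆; ∣_∣)
open import Data.Fin.Subset.Properties
  using (∣p∣≤∣x∷p∣; nonempty?; Empty-unique; ∣⊥∣≡0; ∣⁅x⁆∣≡1; x∈⁅x⁆; p⊆q⇒∣p∣≤∣q∣;
         p⊆p∪q; q⊆p∪q; p∩q⊆p; x∈p∩q⁺; x∈p∩q⁻; x∈∁p⇒x∉p)
open import Data.Vec using (_∷_; []; tabulate)
import Data.Vec as Vec
open import Data.Vec.Properties using (lookup⇒[]=; []=⇒lookup; lookup∘tabulate; tabulate-cong)
open import Data.Product using (∃-syntax; _×_; _,_; proj₁; proj₂)
open import Data.Sum using (inj₁; inj₂; [_,_]′)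
open import Data.Empty using (⊥-elim)
open import Function using (_∘_)
open import Function.Bundles using (Equivalence)
open import Relation.Binary.PropositionalEquality
open import Relation.Nullary using (yes; no; ¬_; contradiction)

private
  variable
    n : ℕ

∣p∪q∣≤∣p∣+∣q∣ : (p q : Subset n) → ∣ p ∪ q ∣ ≤ ∣ p ∣ + ∣ q ∣
∣p∪q∣≤∣p∣+∣q∣ []            []            = z≤n
∣p∪q∣≤∣p∣+∣q∣ (outside ∷ p) (outside ∷ q) = ∣p∪q∣≤∣p∣+∣q∣ p q
∣p∪q∣≤∣p∣+∣q∣ (outside ∷ p) (inside  ∷ q) =
  subst (suc ∣ p ∪ q ∣ ≤_) (sym (+-suc ∣ p ∣ ∣ q ∣)) (s≤s (∣p∪q∣≤∣p∣+∣q∣ p q))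
∣p∪q∣≤∣p∣+∣q∣ (inside  ∷ p) (x       ∷ q) =
  s≤s (≤-trans (∣p∪q∣≤∣p∣+∣q∣ p q) (+-monoʳ-≤ ∣ p ∣ (∣p∣≤∣x∷p∣ x q)))

∣p∣≤1 : (p : Subset n) → (∀ {x y} → x ∈ p → y ∈ p → x ≡ y) → ∣ p ∣ ≤ 1
∣p∣≤1 {n} p unique with nonempty? p
... | yes (x , x∈p) = subst (∣ p ∣ ≤_) (∣⁅x⁆∣≡1 x)
  (p⊆q⇒∣p∣≤∣q∣ (λ y∈p → subst (_∈ ⁅ x ⁆) (unique x∈p y∈p) (x∈⁅x⁆ x)))
... | no empty = subst (λ q → ∣ q ∣ ≤ 1) (sym (Empty-unique empty))
  (subst (_≤ 1) (sym (∣⊥∣≡0 n)) z≤n)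

∈-tabulate⁺ : {f : Fin n → Bool} {i : Fin n} → T (f i) → i ∈ tabulate f
∈-tabulate⁺ {f = f} {i} fi =
  lookup⇒[]= i (tabulate f) (trans (lookup∘tabulate f i) (Equivalence.to T-≡ fi))

∈-tabulate⁻ : {f : Fin n → Bool} {i : Fin n} → i ∈ tabulate f → T (f i)
∈-tabulate⁻ {f = f} {i} i∈ =
  Equivalence.from T-≡ (trans (sym (lookup∘tabulate f i)) ([]=⇒lookup i∈))

memℕ-suc : ∀ a x (C : Subset n) → memℕ (suc a) (x ∷ C) ≡ memℕ a C
memℕ-suc {n} a x C with a <? n | suc a <? suc n
... | yes _   | yes _     = refl
... | no  _   | no  _     = refl
... | yes a<n | no  ¬sa<sn = contradiction (s≤s a<n) ¬sa<sn
... | no  ¬a<n | yes sa<sn = contradiction (s≤s⁻¹ sa<sn) ¬a<n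

memℕ⁻ : ∀ a (C : Subset n) → T (memℕ a C) → ∃[ v ] (toℕ v ≡ a × v ∈ C)
memℕ⁻ {n} a C a∈C with a <? n
... | yes a<n = fromℕ< a<n , toℕ-fromℕ< a<n , lookup⇒[]= _ C (Equivalence.to T-≡ a∈C)
... | no  _   = ⊥-elim a∈C

restrict : ∀ k → Subset n → Subset k
restrict k C = tabulate (λ i → memℕ (toℕ i) C)

∣restrict∣≤∣C∣ : ∀ k (C : Subset n) → ∣ restrict k C ∣ ≤ ∣ C ∣
∣restrict∣≤∣C∣ zero    C       = z≤n
∣restrict∣≤∣C∣ (suc k) []      = ∣restrict∣≤∣C∣ k []
∣restrict∣≤∣C∣ (suc k) (x ∷ C) rewrite tabulate-cong {n = k} (λ i → memℕ-suc (toℕ i) x C)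
  with x
... | outside = ∣restrict∣≤∣C∣ k C
... | inside  = s≤s (∣restrict∣≤∣C∣ k C)

data ChildrenNumbered : ℕ → ℕ → List TEdge → Set where
  []  : ∀ {a} → ChildrenNumbered a a []
  _∷_ : ∀ {a b e es} → child e ≡ a → ChildrenNumbered (suc a) b es →
        ChildrenNumbered a b (e ∷ es)

childrenNumbered-++ : ∀ {a b c xs ys} → ChildrenNumbered a b xs → ChildrenNumbered b c ys →
                      ChildrenNumbered a c (xs ++ ys)
childrenNumbered-++ []         ys = ys
childrenNumbered-++ (x ∷ xs)   ys = x ∷ childrenNumbered-++ xs ys

childrenNumbered-lookup : ∀ {a b es} → ChildrenNumbered a b es →
                          ∀ i → child (lookup es i) ≡ a + toℕ i
childrenNumbered-lookup {a} (c ∷ _)  Fin.zero    = trans c (sym (+-identityʳ a))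
childrenNumbered-lookup {a} (_ ∷ cs) (Fin.suc i) =
  trans (childrenNumbered-lookup cs i) (sym (+-suc a (toℕ i)))

mutual
  edgesT-numbered : ∀ o t → ChildrenNumbered (suc o) (o + size t) (edgesT o t)
  edgesT-numbered o (node ts) rewrite +-suc o (sizes ts) = edgesF-numbered o (suc o) true ts

  edgesF-numbered : ∀ p o b ts → ChildrenNumbered o (o + sizes ts) (edgesF p o b ts)
  edgesF-numbered p o b [] rewrite +-identityʳ o = []
  edgesF-numbered p o b (t ∷ ts) rewrite sym (+-assoc o (size t) (sizes ts)) =
    refl ∷ childrenNumbered-++ (edgesT-numbered o t) (edgesF-numbered p (o + size t) false ts)

child-lookup : ∀ t i → child (lookup (edges t) i) ≡ suc (toℕ i)
child-lookup t = childrenNumbered-lookup (edgesT-numbered 0 t)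

-- topT o τ t v is the top of vertex v, where t is rooted at label o and τ is the top of that
-- root; topF o τ b ts does the same for the siblings ts labelled from o on, b telling whether
-- the head of ts is the first child.  Labels outside the tree get the junk value 0.
mutual
  topT : ℕ → ℕ → PTree → ℕ → ℕ
  topT o τ (node ts) v with v ≟ o
  ... | yes _ = τ
  ... | no  _ = topF (suc o) τ true ts v

  topF : ℕ → ℕ → Bool → List PTree → ℕ → ℕ
  topF o τ b []       v = 0
  topF o τ b (t ∷ ts) v with v <? o + size t
  ... | yes _ = topT o (if b then o else τ) t v
  ... | no  _ = topF (o + size t) τ false ts v

topT-root : ∀ o τ ts → topT o τ (node ts) o ≡ τ
topT-root o τ ts with o ≟ o
... | yes _   = refl
... | no  o≢o = contradiction refl o≢o

topT-below : ∀ {o τ ts v} → v ≢ o → topT o τ (node ts) v ≡ topF (suc o) τ true ts v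
topT-below {o} {v = v} v≢o with v ≟ o
... | yes v≡o = contradiction v≡o v≢o
... | no  _   = refl

topF-here : ∀ {o τ b t ts v} → v < o + size t →
            topF o τ b (t ∷ ts) v ≡ topT o (if b then o else τ) t v
topF-here {o} {t = t} {v = v} v<end with v <? o + size t
... | yes _  = refl
... | no  v≮ = contradiction v<end v≮

topF-later : ∀ {o τ b t ts v} → o + size t ≤ v →
             topF o τ b (t ∷ ts) v ≡ topF (o + size t) τ false ts v
topF-later {o} {t = t} {v = v} end≤v with v <? o + size t
... | yes v<end = contradiction end≤v (<⇒≱ v<end)
... | no  _     = refl

TopLaw : (ℕ → ℕ) → TEdge → Set
TopLaw top (tedge p c true)  = c ≡ suc p × top c ≡ c
TopLaw top (tedge p c false) = top c ≡ top p

AgreeOn : ℕ → ℕ → (ℕ → ℕ) → (ℕ → ℕ) → Set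
AgreeOn lo hi f g = ∀ {v} → lo ≤ v → v < hi → f v ≡ g v

agreeOn-trans : ∀ {lo hi lo′ hi′ g f f′} → AgreeOn lo hi g f → lo ≤ lo′ → hi′ ≤ hi →
         AgreeOn lo′ hi′ f f′ → AgreeOn lo′ hi′ g f′
agreeOn-trans g≗f lo≤lo′ hi′≤hi f≗f′ lo′≤v v<hi′ =
  trans (g≗f (≤-trans lo≤lo′ lo′≤v) (<-≤-trans v<hi′ hi′≤hi)) (f≗f′ lo′≤v v<hi′)

mutual
  topLawT : ∀ o τ t {g} → AgreeOn o (o + size t) g (topT o τ t) → All (TopLaw g) (edgesT o t)
  topLawT o τ (node ts) g≗top =
    topLawF o (suc o) τ true ts (trans (g≗top ≤-refl (m<m+n o z<s)) (topT-root o τ ts)) (λ _ → refl)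
      (agreeOn-trans g≗top (n≤1+n o) (≤-reflexive (sym (+-suc o (sizes ts))))
              (λ o<v _ → topT-below (>⇒≢ o<v)))

  topLawF : ∀ p o τ b ts {g} → g p ≡ τ → (b ≡ true → o ≡ suc p) →
            AgreeOn o (o + sizes ts) g (topF o τ b ts) → All (TopLaw g) (edgesF p o b ts)
  topLawF p o τ b []                _    _     _     = []
  topLawF p o τ b (node us ∷ ts) {g} gp≡τ first g≗top =
    headLaw b first rootTop ∷ ++⁺ (topLawT o τ′ (node us) inSubtree)
                                  (topLawF p (o + size (node us)) τ false ts gp≡τ (λ ()) inRest)
    where
    τ′ : ℕ
    τ′ = if b then o else τ
    inSubtree : AgreeOn o (o + size (node us)) g (topT o τ′ (node us))
    inSubtree = agreeOn-trans g≗top ≤-refl (+-monoʳ-≤ o (m≤m+n (size (node us)) (sizes ts)))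
                  (λ _ → topF-here {o} {τ} {b} {node us} {ts})
    inRest : AgreeOn (o + size (node us)) (o + size (node us) + sizes ts) g
                     (topF (o + size (node us)) τ false ts)
    inRest = agreeOn-trans g≗top (m≤m+n o (size (node us)))
               (≤-reflexive (+-assoc o (size (node us)) (sizes ts)))
               (λ end≤v _ → topF-later {o} {τ} {b} {node us} {ts} end≤v)
    rootTop : g o ≡ τ′
    rootTop = trans (inSubtree ≤-refl (m<m+n o z<s)) (topT-root o τ′ us)
    headLaw : ∀ b → (b ≡ true → o ≡ suc p) → g o ≡ (if b then o else τ) → TopLaw g (tedge p o b)
    headLaw true  o≡1+p go = o≡1+p refl , go
    headLaw false _     go = trans go (sym gp≡τ)

top : PTree → ℕ → ℕ
top t = topT 0 0 t

module _ (t : PTree) where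

  private
    edge : Fin (nE t) → TEdge
    edge = lookup (edges t)

  topLaw : ∀ i → TopLaw (top t) (edge i)
  topLaw i = All.lookup (topLawT 0 0 t (λ _ _ → refl)) (∈-lookup i)

  firstEdge-law : ∀ {i} → i ∈ firstEdges t →
                  child (edge i) ≡ suc (parent (edge i)) × top t (child (edge i)) ≡ child (edge i)
  firstEdge-law {i} i∈F = go (edge i) (∈-tabulate⁻ i∈F) (topLaw i)
    where
    go : ∀ e → T (first e) → TopLaw (top t) e → child e ≡ suc (parent e) × top t (child e) ≡ child e
    go (tedge p c true) _ law = law

  otherEdge-top : ∀ {i} → i ∉ firstEdges t → top t (parent (edge i)) ≡ top t (child (edge i))
  otherEdge-top {i} i∉F = go (edge i) (i∉F ∘ ∈-tabulate⁺) (topLaw i)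
    where
    go : ∀ e → ¬ T (first e) → TopLaw (top t) e → top t (parent e) ≡ top t (child e)
    go (tedge p c false) _   law = sym law
    go (tedge p c true)  ¬fe _   = contradiction _ ¬fe

  firstEdge-parent : ∀ {i} → i ∈ firstEdges t → parent (edge i) ≡ toℕ i
  firstEdge-parent {i} i∈F =
    suc-injective (trans (sym (proj₁ (firstEdge-law i∈F))) (child-lookup t i))

reach-preserves : ∀ {t K} (g : ℕ → ℕ) → (∀ {e} → e ∈ K → g (endA t e) ≡ g (endB t e)) →
                  ∀ {u v} → Reach t K u v → g (toℕ u) ≡ g (toℕ v)
reach-preserves g g-const here = refl
reach-preserves {t} g g-const (step e e∈K joins r) =
  trans (across joins) (reach-preserves g g-const r)
  where
  across : ∀ {u w} → Joins t e u w → g (toℕ u) ≡ g (toℕ w)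
  across (inj₁ (a≡u , b≡w)) = trans (cong g (sym a≡u)) (trans (g-const e∈K) (cong g b≡w))
  across (inj₂ (a≡w , b≡u)) = trans (cong g (sym b≡u)) (trans (sym (g-const e∈K)) (cong g a≡w))

degree≤1+∣C∣ : ∀ t (E″ K : Subset (nE t)) (C : Subset (size t)) (c : Fin (size t)) →
               E″ ⊆ firstEdges t → (∀ {e} → e ∈ K → e ∉ firstEdges t) →
               (∀ {v} → v ∈ C → Reach t K c v) → degree t E″ C ≤ suc ∣ C ∣
degree≤1+∣C∣ t E″ K C c E″⊆F K∩F≡∅ reach = begin
  ∣ incident ∣          ≤⟨ p⊆q⇒∣p∣≤∣q∣ incident⊆entering∪leaving ⟩
  ∣ entering ∪ leaving ∣ ≤⟨ ∣p∪q∣≤∣p∣+∣q∣ entering leaving ⟩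
  ∣ entering ∣ + ∣ leaving ∣
    ≤⟨ +-mono-≤ (∣p∣≤1 entering entering-unique) (∣restrict∣≤∣C∣ (nE t) C) ⟩
  suc ∣ C ∣ ∎
  where
  open ≤-Reasoning
  edge : Fin (nE t) → TEdge
  edge = lookup (edges t)
  incident entering leaving : Subset (nE t)
  incident = tabulate (λ i → Vec.lookup E″ i ∧ (memℕ (endA t i) C ∨ memℕ (endB t i) C))
  entering = tabulate (λ i → first (edge i) ∧ memℕ (child (edge i)) C)
  leaving  = restrict (nE t) C

  incident⊆entering∪leaving : incident ⊆ entering ∪ leaving
  incident⊆entering∪leaving {i} i∈incident with Equivalence.to T-∧ (∈-tabulate⁻ i∈incident)
  ... | i∈E″ , ends = [ leavesDown , entersFromAbove ]′ (Equivalence.to T-∨ ends)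
    where
    i∈F : i ∈ firstEdges t
    i∈F = E″⊆F (lookup⇒[]= i E″ (Equivalence.to T-≡ i∈E″))
    leavesDown : T (memℕ (endA t i) C) → i ∈ entering ∪ leaving
    leavesDown parent∈C =
      q⊆p∪q entering leaving
        (∈-tabulate⁺ (subst (λ a → T (memℕ a C)) (firstEdge-parent t i∈F) parent∈C))
    entersFromAbove : T (memℕ (endB t i) C) → i ∈ entering ∪ leaving
    entersFromAbove child∈C =
      p⊆p∪q leaving (∈-tabulate⁺ (Equivalence.from T-∧ (∈-tabulate⁻ i∈F , child∈C)))

  top-const : ∀ {v} → v ∈ C → top t (toℕ c) ≡ top t (toℕ v)
  top-const v∈C = reach-preserves (top t) (λ e∈K → otherEdge-top t (K∩F≡∅ e∈K)) (reach v∈C)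

  entering-top : ∀ {i} → i ∈ entering → suc (toℕ i) ≡ top t (toℕ c)
  entering-top {i} i∈entering with Equivalence.to T-∧ (∈-tabulate⁻ i∈entering)
  ... | first-i , child∈C with memℕ⁻ (child (edge i)) C child∈C
  ...   | v , v≡child , v∈C = begin-equality
    suc (toℕ i)           ≡⟨ child-lookup t i ⟨
    child (edge i)        ≡⟨ proj₂ (firstEdge-law t (∈-tabulate⁺ first-i)) ⟨
    top t (child (edge i)) ≡⟨ cong (top t) v≡child ⟨
    top t (toℕ v)         ≡⟨ top-const v∈C ⟨
    top t (toℕ c)         ∎

  entering-unique : ∀ {i j} → i ∈ entering → j ∈ entering → i ≡ j
  entering-unique i∈ j∈ =
    toℕ-injective (suc-injective (trans (entering-top i∈) (sym (entering-top j∈))))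

distributableCapacity : ∀ t V (EV E″ : Subset (nE t)) → E″ ⊆ firstEdges t →
                        (∀ {e} → e ∈ EV → e ∈ firstEdges t → e ∈ E″) →
                        DistributableCapacity t V EV E″
distributableCapacity t V EV E″ E″⊆F EV∩F⊆E″ C (_ , c , _ , C⇔reach) =
  m≤n+o⇒m∸n≤o (degree t E″ C) 1
    (degree≤1+∣C∣ t E″ (EV ∩ ∁ E″) C c E″⊆F otherEdges (Equivalence.to (C⇔reach _)))
  where
  otherEdges : ∀ {e} → e ∈ EV ∩ ∁ E″ → e ∉ firstEdges t
  otherEdges e∈K e∈F with x∈p∩q⁻ EV (∁ E″) e∈K
  ... | e∈EV , e∉E″ = x∈∁p⇒x∉p e∉E″ (EV∩F⊆E″ e∈EV e∈F)

proposition3p6 :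
    (s : PTree) →
    DistributableCapacity (node (s ∷ [])) ⊤ ⊤ (firstEdges (node (s ∷ [])))
    × (∀ (E' : Subset (nE (node (s ∷ [])))) →
         (∀ e → e ∈ E' → e ∉ firstEdges (node (s ∷ []))) →
         ∀ (U : Subset (size (node (s ∷ [])))) →
         IsComponent (node (s ∷ [])) ⊤ (∁ E') U →
         DistributableCapacity (node (s ∷ [])) U
           (edgesWithin (node (s ∷ [])) (∁ E') U)
           (firstEdges (node (s ∷ [])) ∩ edgesWithin (node (s ∷ [])) (∁ E') U))
proposition3p6 s =
  distributableCapacity tree ⊤ ⊤ F (λ e∈F → e∈F) (λ _ e∈F → e∈F) ,
  λ E′ _ U _ → let EU = edgesWithin tree (∁ E′) U in
    distributableCapacity tree U EU (F ∩ EU) (p∩q⊆p F EU) (λ e∈EU e∈F → x∈p∩q⁺ (e∈F , e∈EU))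
  where
  tree : PTree
  tree = node (s ∷ [])
  F : Subset (nE tree)
  F = firstEdges tree
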